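{- Let $G=(V,E)$ and the algorithm be as described in the context. In a stable configuration, $PRcondemned(i)$ is false for every $i\in V$, where $PRcondemned(i)\equiv \exists j\in N(i): (p_i=j \text{ and } p_j\neq i \text{ and } PRmarried(j))$.
   Context: Let $G=(V,E)$ be a finite simple undirected graph; each node is a process and $N(i)$ denotes the set of neighbours of $i$. Each process has an identifier from a totally ordered set; identifiers of any two distinct processes at distance at most $2$ are distinct, and comparisons such as $j>i$ between processes are comparisons of their identifiers. Each process $i$ holds variables $m_i\in\{\text{true},\text{false}\}$ and $p_i\in\{null\}\cup N(i)$; a configuration is an assignment of values to all these variables. Define the predicate $PRmarried(i)\equiv \exists j\in N(i): (p_i=j \text{ and } p_j=i)$. The algorithm consists of the following four guarded rules for each process $i$ (a rule is enabled at $i$ if its guard holds): Update: if $m_i\neq PRmarried(i)$ then $m_i:=PRmarried(i)$. Marriage: if $m_i=PRmarried(i)$ and $p_i=null$ and there is $j\in N(i)$ with $p_j=i$, then $p_i:=j$ (for such a $j$). Seduction: if $m_i=PRmarried(i)$ and $p_i=null$ and $p_k\neq i$ for all $k\in N(i)$ and there is $j\in N(i)$ with $p_j=null$, $j>i$ and $m_j=\text{false}$, then $p_i:=\max\{j\in N(i): p_j=null,\ j>i,\ m_j=\text{false}\}$. Abandonment: if $m_i=PRmarried(i)$ and $p_i=j\neq null$ and $p_j\neq i$ and ($m_j=\text{true}$ or $j\le i$), then $p_i:=null$. A process is eligible if some rule is enabled at it. A configuration is stable if no process is eligible. -}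

module Defs where

open import Level using (Level; _⊔_) renaming (suc to lsuc)
open import Data.Nat using (ℕ)
open import Data.Fin using (Fin)
open import Data.Bool using (Bool; true; false)
open import Data.Maybe using (Maybe; just; nothing)
open import Data.Product using (Σ; ∃; ∃-syntax; _×_; _,_)
open import Data.Sum using (_⊎_)
open import Relation.Nullary using (¬_)
open import Relation.Binary.PropositionalEquality using (_≡_; _≢_)
open import Relation.Binary.Bundles using (StrictTotalOrder)
open import Function.Bundles using (_⇔_)

record Graph (n : ℕ) : Set₁ where
  field
    Adj   : Fin n → Fin n → Set
    sym   : ∀ {i j} → Adj i j → Adj j i
    irrefl : ∀ {i} → ¬ Adj i i

module Algorithm {c ℓ₁ ℓ₂ : Level} (O : StrictTotalOrder c ℓ₁ ℓ₂)
                 {n : ℕ} (G : Graph n) where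
  open StrictTotalOrder O renaming (Carrier to Id)
  open Graph G

  Within2 : Fin n → Fin n → Set
  Within2 i j = Adj i j ⊎ (∃[ k ] (Adj i k × Adj k j))

  LocallyUnique : (Fin n → Id) → Set _
  LocallyUnique ident = ∀ i j → i ≢ j → Within2 i j → ¬ (ident i ≈ ident j)

  -- A configuration: m_i ∈ {true,false}, p_i ∈ {null} ∪ N(i)
  -- (null is represented by nothing).
  record Config : Set where
    field
      m : Fin n → Bool
      p : Fin n → Maybe (Fin n)
      p-nbr : ∀ i j → p i ≡ just j → Adj i j

  module _ (ident : Fin n → Id) (C : Config) where
    open Config C

    _≻_ : Fin n → Fin n → Set _
    j ≻ i = ident i < ident j

    _≼_ : Fin n → Fin n → Set _
    j ≼ i = ident j < ident i ⊎ ident j ≈ ident i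

    PRmarried : Fin n → Set
    PRmarried i = ∃[ j ] (Adj i j × p i ≡ just j × p j ≡ just i)

    Consistent : Fin n → Set
    Consistent i = (m i ≡ true) ⇔ PRmarried i

    UpdateEnabled : Fin n → Set
    UpdateEnabled i = ¬ Consistent i

    MarriageEnabled : Fin n → Set
    MarriageEnabled i =
      Consistent i × p i ≡ nothing × (∃[ j ] (Adj i j × p j ≡ just i))

    SeductionEnabled : Fin n → Set _
    SeductionEnabled i =
      Consistent i × p i ≡ nothing
      × (∀ k → Adj i k → p k ≢ just i)
      × (∃[ j ] (Adj i j × p j ≡ nothing × j ≻ i × m j ≡ false))

    AbandonmentEnabled : Fin n → Set _
    AbandonmentEnabled i =
      Consistent i
      × (∃[ j ] (p i ≡ just j × p j ≢ just i × (m j ≡ true ⊎ j ≼ i)))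

    Eligible : Fin n → Set _
    Eligible i = UpdateEnabled i ⊎ MarriageEnabled i
                 ⊎ SeductionEnabled i ⊎ AbandonmentEnabled i

    Stable : Set _
    Stable = ∀ i → ¬ Eligible i

    PRcondemned : Fin n → Set
    PRcondemned i = ∃[ j ] (Adj i j × p i ≡ just j × p j ≢ just i × PRmarried j)

module Submission where

open import Defs
open import Level using (Level)
open import Data.Nat using (ℕ)
open import Relation.Nullary using (¬_)
open import Relation.Binary.Bundles using (StrictTotalOrder)
open import Data.Fin using (Fin)
open import Data.Bool using (true)
open import Data.Bool.Properties using (_≟_)
open import Data.Sum using (inj₁; inj₂)
open import Data.Product using (_,_)
open import Data.Empty using (⊥-elim)
open import Function.Bundles using (Equivalence)
open import Relation.Binary.PropositionalEquality using (_≡_)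
open import Relation.Nullary.Decidable using (yes; no)

-- A condemned process i points to a married partner j that does not point
-- back. Stability at j rules out Update, which forces m j = true. Then, if i
-- were consistent, Abandonment would be enabled at i; so i is inconsistent and
-- Update is enabled at i.

module _ {c ℓ₁ ℓ₂ : Level} (O : StrictTotalOrder c ℓ₁ ℓ₂) {n : ℕ} (G : Graph n)
         (ident : Fin n → StrictTotalOrder.Carrier O) (C : Algorithm.Config O G) where
  open Algorithm O G
  open Config C

  -- Consistency need not be decidable, so stability only refutes
  -- inconsistency; the case split happens on the Boolean m j instead.
  stable∧married⇒m≡true : Stable ident C → ∀ {j} → PRmarried ident C j → m j ≡ true
  stable∧married⇒m≡true stable {j} married with m j ≟ true
  ... | yes m≡true = m≡true
  ... | no  m≢true = ⊥-elim (stable j (inj₁ λ consistent →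
                              m≢true (Equivalence.from consistent married)))

  condemned⇒eligible : Stable ident C → ∀ {i} → PRcondemned ident C i → Eligible ident C i
  condemned⇒eligible stable (j , _ , pi≡j , pj≢i , married) = inj₁ λ consistent →
    stable _ (inj₂ (inj₂ (inj₂
      (consistent , j , pi≡j , pj≢i , inj₁ (stable∧married⇒m≡true stable married)))))

lemma2 : {c ℓ₁ ℓ₂ : Level} (O : StrictTotalOrder c ℓ₁ ℓ₂) {n : ℕ} (G : Graph n)
         (ident : Fin n → StrictTotalOrder.Carrier O)
         → Algorithm.LocallyUnique O G ident
         → (C : Algorithm.Config O G)
         → Algorithm.Stable O G ident C
         → ∀ i → ¬ Algorithm.PRcondemned O G ident C i
lemma2 O G ident _ C stable i condemned = stable i (condemned⇒eligible O G ident C stable condemned)
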